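{- Let $q$ be an odd prime power, $d\ge 2$, $t\in\mathbb{F}_q^*$, and $E\subseteq\mathbb{F}_q^d$. Let $H$ be a finite simple graph with vertex set $V$, let $S=\{v_1,\dots,v_n\}\subseteq V$, write $V\setminus S=\{w_1,\dots,w_l\}$, let $k\ge 2$, and let $G$ be the $k$-Hölder extension of $H$ with respect to $S$. Assume $\mathcal N_{H\setminus S}(E)>0$. Then \[ \mathcal N_G(E)\ \ge\ \frac{(\mathcal N_H(E))^k}{(\mathcal N_{H\setminus S}(E))^{k-1}}. \]
   Context: For $x\in\mathbb{F}_q^d$, $\lVert x\rVert=x_1^2+\dots+x_d^2$. All edges of all graphs are assigned the same length $t$. An embedding of a graph $\Gamma=(V_\Gamma,E_\Gamma)$ in $E$ is a map $\varphi:V_\Gamma\to E$ such that $\lVert\varphi(u)-\varphi(w)\rVert=t$ for every edge $uw\in E_\Gamma$ (not required to be injective); $\mathcal N_\Gamma(E)$ is the number of such maps. $H\setminus S$ denotes the induced subgraph of $H$ on $V\setminus S$. The $k$-Hölder extension of $H$ with respect to $S$ is the graph $G$ whose vertex set is $V$ together with $k-1$ new copies $\{v_j^i:1\le j\le n,\ 1\le i\le k-1\}$ of the vertices of $S$; its edges are the edges of $H$ (on $V\times V$), together with: $v_j^i$ adjacent to $w\in V\setminus S$ iff $v_j$ is adjacent to $w$ in $H$, and $v_j^i$ adjacent to $v_{j'}^{i}$ (same copy index $i$) iff $v_j$ is adjacent to $v_{j'}$ in $H$; there are no other edges. -}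

module Defs where

open import Data.Nat using (ℕ; zero; suc; _+_; _*_; _∸_)
open import Data.Bool using (Bool; true; false; _∧_; _∨_; not; if_then_else_)
open import Data.Fin using (Fin; _↑ˡ_; _↑ʳ_; splitAt; remQuot)
import Data.Fin as Fin
open import Data.Sum using (inj₁; inj₂)
open import Data.Product using (_,_; ∃)
open import Data.List using (List; []; _∷_; length; allFin; concatMap; map)
open import Data.Vec using (Vec; []; _∷_; lookup; zipWith; foldr)
open import Data.List.Membership.Propositional using (_∈_)
open import Data.List.Relation.Unary.Unique.Propositional using (Unique)
open import Relation.Binary.PropositionalEquality using (_≡_; _≢_)
open import Relation.Binary.Definitions using (DecidableEquality)
open import Relation.Nullary.Decidable using (⌊_⌋)
open import Algebra.Structures using (IsCommutativeRing)

-- A finite field of odd characteristic (i.e. F_q with q an odd prime power),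
-- with propositional equality, decidable equality and an exhaustive
-- duplicate-free enumeration of its elements.
record FiniteOddField : Set₁ where
  field
    F     : Set
    _+F_  : F → F → F
    _*F_  : F → F → F
    -F_   : F → F
    0F 1F : F
    isCommutativeRing : IsCommutativeRing _≡_ _+F_ _*F_ -F_ 0F 1F
    0≢1     : 0F ≢ 1F
    inverse : ∀ x → x ≢ 0F → ∃ λ y → x *F y ≡ 1F
    _≟F_    : DecidableEquality F
    elems          : List F
    elems-complete : ∀ x → x ∈ elems
    elems-unique   : Unique elems
    odd-char : (1F +F 1F) ≢ 0F

  order : ℕ
  order = length elems

open FiniteOddField public

allVecs : ∀ {A : Set} → List A → (n : ℕ) → List (Vec A n)
allVecs xs zero    = [] ∷ []
allVecs xs (suc n) = concatMap (λ x → map (x ∷_) (allVecs xs n)) xs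

allB : ∀ {A : Set} → (A → Bool) → List A → Bool
allB p []       = true
allB p (x ∷ xs) = p x ∧ allB p xs

countTrue : ∀ {A : Set} → (A → Bool) → List A → ℕ
countTrue p []       = 0
countTrue p (x ∷ xs) = (if p x then 1 else 0) + countTrue p xs

module _ (𝔽 : FiniteOddField) where
  norm : ∀ {d} → Vec (F 𝔽) d → F 𝔽
  norm = foldr _ (λ a acc → _+F_ 𝔽 (_*F_ 𝔽 a a) acc) (0F 𝔽)

  vsub : ∀ {d} → Vec (F 𝔽) d → Vec (F 𝔽) d → Vec (F 𝔽) d
  vsub = zipWith (λ a b → _+F_ 𝔽 a (-F_ 𝔽 b))

  isEmbedding : ∀ {d m} → (t : F 𝔽) → (E : Vec (F 𝔽) d → Bool)
              → (Fin m → Fin m → Bool) → Vec (Vec (F 𝔽) d) m → Bool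
  isEmbedding {m = m} t E adj φ =
    allB (λ i → E (lookup φ i)) (allFin m) ∧
    allB (λ i → allB (λ j → not (adj i j) ∨
                   ⌊ _≟F_ 𝔽 (norm (vsub (lookup φ i) (lookup φ j))) t ⌋)
                   (allFin m)) (allFin m)

  -- 𝒩_Γ(E): number of maps V_Γ → E that are embeddings (not nec. injective)
  𝒩 : ∀ {d m} → (t : F 𝔽) → (E : Vec (F 𝔽) d → Bool)
    → (Fin m → Fin m → Bool) → ℕ
  𝒩 {d} {m} t E adj = countTrue (isEmbedding t E adj) (allVecs (allVecs (elems 𝔽) d) m)

record SimpleGraph (m : ℕ) : Set where
  field
    adj    : Fin m → Fin m → Bool
    sym    : ∀ i j → adj i j ≡ adj j i
    irrefl : ∀ i → adj i i ≡ false
open SimpleGraph public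

-- Graphs whose vertex set is V = S ⊔ (V∖S) with S = {v₁..vₙ} the first n
-- vertices (v_j ↦ j ↑ˡ l) and V∖S = {w₁..w_l} the last l (w_j ↦ n ↑ʳ j).

deleteS : ∀ n l → (Fin (n + l) → Fin (n + l) → Bool) → Fin l → Fin l → Bool
deleteS n l a x y = a (n ↑ʳ x) (n ↑ʳ y)

data HVert (n l k : ℕ) : Set where
  orig : Fin (n + l) → HVert n l k
  copy : Fin (k ∸ 1) → Fin n → HVert n l k

decodeH : ∀ n l k → Fin ((n + l) + (k ∸ 1) * n) → HVert n l k
decodeH n l k x with splitAt (n + l) x
... | inj₁ a = orig a
... | inj₂ c with remQuot {k ∸ 1} n c
...   | (i , j) = copy i j

hadj : ∀ n l k → (Fin (n + l) → Fin (n + l) → Bool) → HVert n l k → HVert n l k → Bool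
hadj n l k a (orig x) (orig y) = a x y
hadj n l k a (copy i j) (orig y) with splitAt n y
... | inj₁ _ = false
... | inj₂ w = a (j ↑ˡ l) (n ↑ʳ w)
hadj n l k a (orig x) (copy i j) with splitAt n x
... | inj₁ _ = false
... | inj₂ w = a (n ↑ʳ w) (j ↑ˡ l)
hadj n l k a (copy i j) (copy i' j') =
  ⌊ i Fin.≟ i' ⌋ ∧ a (j ↑ˡ l) (j' ↑ˡ l)

-- adjacency of the k-Hölder extension G of H w.r.t. S, on vertex set
-- Fin ((n + l) + (k - 1) * n): first the n + l original vertices, then the
-- (k-1) copies of S.
holderExt : ∀ n l k → (Fin (n + l) → Fin (n + l) → Bool)
          → Fin ((n + l) + (k ∸ 1) * n) → Fin ((n + l) + (k ∸ 1) * n) → Bool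
holderExt n l k a x y = hadj n l k a (decodeH n l k x) (decodeH n l k y)

{-# OPTIONS --safe #-}
module Submission where

-- G is k copies of H glued along H ∖ S: an embedding of G is the same as k embeddings of H
-- that agree on V ∖ S. Writing f(w) for the number of embeddings of H extending a map w of
-- V ∖ S, this gives 𝒩_H = Σ_w f(w) and 𝒩_G = Σ_w f(w)^k, while f(w) = 0 unless w embeds
-- H ∖ S. The power-mean inequality (Σ f)^k ≤ N^(k-1) Σ f^k over the N = 𝒩_{H∖S} embeddings
-- of H ∖ S is then exactly the claim.

open import Defs hiding (sym)
open import Data.Bool using (Bool; true; false; T; _∨_; not; if_then_else_)
open import Data.Bool.Properties using (T-∧)
open import Data.Empty using (⊥-elim)
open import Data.Fin using (Fin; _↑ˡ_; _↑ʳ_; splitAt; combine; remQuot)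
import Data.Fin as Fin
open import Data.Fin.Properties
  using (splitAt-↑ˡ; splitAt-↑ʳ; splitAt⁻¹-↑ˡ; splitAt⁻¹-↑ʳ; remQuot-combine; combine-remQuot)
open import Data.List using (List; []; _∷_; map; concatMap; filterᵇ; length; allFin)
  renaming (_++_ to _++ᴸ_)
open import Data.List.Membership.Propositional using (_∈_)
open import Data.List.Membership.Propositional.Properties using (∈-allFin)
open import Data.List.Relation.Unary.Any using (here; there)
open import Data.Nat using (ℕ; zero; suc; _+_; _*_; _^_; _∸_; _≤_; _<_; z≤n)
open import Data.Nat.Properties
open import Data.Nat.Tactic.RingSolver using (solve-∀)
open import Data.Product using (_×_; _,_; proj₁; proj₂; ∃; ∃₂)
open import Data.Sum using (inj₁; inj₂; [_,_]′)
open import Data.Unit using (⊤; tt)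
open import Data.Vec using (Vec; _∷_; _++_; lookup; tabulate)
open import Data.Vec.Properties using (lookup-++ˡ; lookup-++ʳ; lookup∘tabulate; tabulate-cong; tabulate∘lookup)
open import Function using (_∘_; _⇔_; mk⇔; Equivalence)
import Function.Properties.Equivalence as ⇔
open import Function.Related.Propositional using (module EquationalReasoning)
open import Relation.Binary.PropositionalEquality
open import Relation.Nullary using (yes; no)
open import Relation.Nullary.Decidable using (⌊_⌋)

private variable A B Pt V W I : Set

∑ : List A → (A → ℕ) → ℕ
∑ []       f = 0
∑ (x ∷ xs) f = f x + ∑ xs f

∑-cong : ∀ (xs : List A) {f g : A → ℕ} → (∀ x → f x ≡ g x) → ∑ xs f ≡ ∑ xs g
∑-cong []       f≗g = refl
∑-cong (x ∷ xs) f≗g = cong₂ _+_ (f≗g x) (∑-cong xs f≗g)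

∑-mono-≤ : ∀ (xs : List A) {f g : A → ℕ} → (∀ x → f x ≤ g x) → ∑ xs f ≤ ∑ xs g
∑-mono-≤ []       f≤g = z≤n
∑-mono-≤ (x ∷ xs) f≤g = +-mono-≤ (f≤g x) (∑-mono-≤ xs f≤g)

∑-++ : ∀ (xs ys : List A) (f : A → ℕ) → ∑ (xs ++ᴸ ys) f ≡ ∑ xs f + ∑ ys f
∑-++ []       ys f = refl
∑-++ (x ∷ xs) ys f = trans (cong (f x +_) (∑-++ xs ys f)) (sym (+-assoc (f x) _ _))

∑-map : ∀ (xs : List A) (h : A → B) (f : B → ℕ) → ∑ (map h xs) f ≡ ∑ xs (λ x → f (h x))
∑-map []       h f = refl
∑-map (x ∷ xs) h f = cong (f (h x) +_) (∑-map xs h f)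

∑-concatMap : ∀ (xs : List A) (g : A → List B) (f : B → ℕ) →
              ∑ (concatMap g xs) f ≡ ∑ xs (λ x → ∑ (g x) f)
∑-concatMap []       g f = refl
∑-concatMap (x ∷ xs) g f =
  trans (∑-++ (g x) (concatMap g xs) f) (cong (∑ (g x) f +_) (∑-concatMap xs g f))

∑-zero : ∀ (xs : List A) → ∑ xs (λ _ → 0) ≡ 0
∑-zero []       = refl
∑-zero (x ∷ xs) = ∑-zero xs

∑-+ : ∀ (xs : List A) (f g : A → ℕ) → ∑ xs (λ x → f x + g x) ≡ ∑ xs f + ∑ xs g
∑-+ []       f g = refl
∑-+ (x ∷ xs) f g = trans (cong (f x + g x +_) (∑-+ xs f g)) (+-interchange (f x) (g x) _ _)
  where
  +-interchange : ∀ a b c d → (a + b) + (c + d) ≡ (a + c) + (b + d)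
  +-interchange = solve-∀

∑-*ˡ : ∀ (xs : List A) (c : ℕ) (f : A → ℕ) → ∑ xs (λ x → c * f x) ≡ c * ∑ xs f
∑-*ˡ []       c f = sym (*-zeroʳ c)
∑-*ˡ (x ∷ xs) c f = trans (cong (c * f x +_) (∑-*ˡ xs c f)) (sym (*-distribˡ-+ c (f x) _))

∑-*ʳ : ∀ (xs : List A) (c : ℕ) (f : A → ℕ) → ∑ xs (λ x → f x * c) ≡ ∑ xs f * c
∑-*ʳ xs c f = trans (∑-cong xs (λ x → *-comm (f x) c)) (trans (∑-*ˡ xs c f) (*-comm c _))

∑-swap : ∀ (xs : List A) (ys : List B) (f : A → B → ℕ) →
         ∑ xs (λ x → ∑ ys (f x)) ≡ ∑ ys (λ y → ∑ xs (λ x → f x y))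
∑-swap []       ys f = sym (∑-zero ys)
∑-swap (x ∷ xs) ys f =
  trans (cong (∑ ys (f x) +_) (∑-swap xs ys f)) (sym (∑-+ ys (f x) (λ y → ∑ xs (λ x′ → f x′ y))))

∑-const : ∀ (xs : List A) c → ∑ xs (λ _ → c) ≡ length xs * c
∑-const []       c = refl
∑-const (x ∷ xs) c = cong (c +_) (∑-const xs c)

toℕ : Bool → ℕ
toℕ b = if b then 1 else 0

countTrue≡∑ : ∀ (p : A → Bool) (xs : List A) → countTrue p xs ≡ ∑ xs (toℕ ∘ p)
countTrue≡∑ p []       = refl
countTrue≡∑ p (x ∷ xs) = cong (toℕ (p x) +_) (countTrue≡∑ p xs)

∑-toℕ≡length-filterᵇ : ∀ (xs : List A) (p : A → Bool) → ∑ xs (toℕ ∘ p) ≡ length (filterᵇ p xs)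
∑-toℕ≡length-filterᵇ []       p = refl
∑-toℕ≡length-filterᵇ (x ∷ xs) p with p x
... | true  = cong suc (∑-toℕ≡length-filterᵇ xs p)
... | false = ∑-toℕ≡length-filterᵇ xs p

∑-filterᵇ : ∀ (xs : List A) (p : A → Bool) (f : A → ℕ) → (∀ x → p x ≡ false → f x ≡ 0) →
            ∑ xs f ≡ ∑ (filterᵇ p xs) f
∑-filterᵇ []       p f f-vanishes = refl
∑-filterᵇ (x ∷ xs) p f f-vanishes with p x in px
... | true  = cong (f x +_) (∑-filterᵇ xs p f f-vanishes)
... | false = trans (cong (_+ ∑ xs f) (f-vanishes x px)) (∑-filterᵇ xs p f f-vanishes)

-- (x ^ k - y ^ k) (x - y) ≥ 0, with both sides moved so that no subtraction occurs.
^-cross-≤-ordered : ∀ k {x y} → x ≤ y → x ^ k * y + x * y ^ k ≤ x ^ suc k + y ^ suc k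
^-cross-≤-ordered k {x} x≤y with m≤n⇒∃[o]m+o≡n x≤y | m≤n⇒∃[o]m+o≡n (^-monoˡ-≤ k x≤y)
... | e , refl | D , xᵏ+D≡yᵏ rewrite sym xᵏ+D≡yᵏ =
  ≤-trans (m≤m+n _ (e * D)) (≤-reflexive (expand (x ^ k) x e D))
  where
  expand : ∀ X x e D → X * (x + e) + x * (X + D) + e * D ≡ x * X + (x + e) * (X + D)
  expand = solve-∀

^-cross-≤ : ∀ k x y → x ^ k * y + x * y ^ k ≤ x ^ suc k + y ^ suc k
^-cross-≤ k x y with ≤-total x y
... | inj₁ x≤y = ^-cross-≤-ordered k x≤y
... | inj₂ y≤x = begin
  x ^ k * y + x * y ^ k ≡⟨ cong₂ _+_ (*-comm (x ^ k) y) (*-comm x (y ^ k)) ⟩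
  y * x ^ k + y ^ k * x ≡⟨ +-comm (y * x ^ k) _ ⟩
  y ^ k * x + y * x ^ k ≤⟨ ^-cross-≤-ordered k y≤x ⟩
  y ^ suc k + x ^ suc k ≡⟨ +-comm (y ^ suc k) _ ⟩
  x ^ suc k + y ^ suc k ∎
  where open ≤-Reasoning

chebyshev : ∀ (xs : List A) (f : A → ℕ) k →
            ∑ xs (λ x → f x ^ k) * ∑ xs f ≤ length xs * ∑ xs (λ x → f x ^ suc k)
chebyshev []       f k = z≤n
chebyshev (x ∷ xs) f k = begin
  (a ^ k + Sₖ) * (a + S₁)                              ≡⟨ expand (a ^ k) Sₖ a S₁ ⟩
  a ^ k * a + (a ^ k * S₁ + a * Sₖ) + Sₖ * S₁           ≤⟨ +-mono-≤ (+-monoʳ-≤ (a ^ k * a) cross) (chebyshev xs f k) ⟩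
  a ^ k * a + (Sₖ₊₁ + m * (a * a ^ k)) + m * Sₖ₊₁       ≡⟨ collect (a ^ k) a Sₖ₊₁ m ⟩
  (1 + m) * (a * a ^ k + Sₖ₊₁)                         ∎
  where
  open ≤-Reasoning
  a m S₁ Sₖ Sₖ₊₁ : ℕ
  a = f x
  m = length xs
  S₁ = ∑ xs f
  Sₖ = ∑ xs (λ y → f y ^ k)
  Sₖ₊₁ = ∑ xs (λ y → f y ^ suc k)
  expand : ∀ P Q a S → (P + Q) * (a + S) ≡ P * a + (P * S + a * Q) + Q * S
  expand = solve-∀
  collect : ∀ P a R m → P * a + (R + m * (a * P)) + m * R ≡ (1 + m) * (a * P + R)
  collect = solve-∀
  cross : a ^ k * S₁ + a * Sₖ ≤ Sₖ₊₁ + m * (a * a ^ k)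
  cross = begin
    a ^ k * S₁ + a * Sₖ
      ≡⟨ sym (cong₂ _+_ (∑-*ˡ xs (a ^ k) f) (∑-*ˡ xs a (λ y → f y ^ k))) ⟩
    ∑ xs (λ y → a ^ k * f y) + ∑ xs (λ y → a * f y ^ k)
      ≡⟨ sym (∑-+ xs _ _) ⟩
    ∑ xs (λ y → a ^ k * f y + a * f y ^ k)
      ≤⟨ ∑-mono-≤ xs (λ y → ^-cross-≤ k a (f y)) ⟩
    ∑ xs (λ y → a ^ suc k + f y ^ suc k)
      ≡⟨ ∑-+ xs _ _ ⟩
    ∑ xs (λ _ → a ^ suc k) + Sₖ₊₁
      ≡⟨ trans (cong (_+ Sₖ₊₁) (∑-const xs (a ^ suc k))) (+-comm _ Sₖ₊₁) ⟩
    Sₖ₊₁ + m * (a * a ^ k) ∎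

power-mean : ∀ (xs : List A) (f : A → ℕ) k →
             ∑ xs f ^ suc k ≤ ∑ xs (λ x → f x ^ suc k) * length xs ^ k
power-mean xs f zero = ≤-reflexive (begin
  ∑ xs f * 1                    ≡⟨ *-identityʳ _ ⟩
  ∑ xs f                        ≡⟨ ∑-cong xs (λ x → sym (*-identityʳ (f x))) ⟩
  ∑ xs (λ x → f x * 1)          ≡⟨ sym (*-identityʳ _) ⟩
  ∑ xs (λ x → f x * 1) * 1      ∎)
  where open ≡-Reasoning
power-mean xs f (suc k) = begin
  S * S ^ suc k         ≤⟨ *-monoʳ-≤ S (power-mean xs f k) ⟩
  S * (Pₖ₊₁ * m ^ k)    ≡⟨ regroup S Pₖ₊₁ (m ^ k) ⟩
  (Pₖ₊₁ * S) * m ^ k    ≤⟨ *-monoˡ-≤ (m ^ k) (chebyshev xs f (suc k)) ⟩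
  (m * Pₖ₊₂) * m ^ k    ≡⟨ regroup′ m Pₖ₊₂ (m ^ k) ⟩
  Pₖ₊₂ * (m * m ^ k)    ∎
  where
  open ≤-Reasoning
  S m Pₖ₊₁ Pₖ₊₂ : ℕ
  S = ∑ xs f
  m = length xs
  Pₖ₊₁ = ∑ xs (λ x → f x ^ suc k)
  Pₖ₊₂ = ∑ xs (λ x → f x ^ suc (suc k))
  regroup : ∀ a b c → a * (b * c) ≡ (b * a) * c
  regroup = solve-∀
  regroup′ : ∀ a b c → (a * b) * c ≡ b * (a * c)
  regroup′ = solve-∀

power-mean-on-support : ∀ (xs : List A) (p : A → Bool) (f : A → ℕ) k →
  (∀ x → p x ≡ false → f x ≡ 0) →
  ∑ xs f ^ suc k ≤ ∑ xs (λ x → f x ^ suc k) * ∑ xs (toℕ ∘ p) ^ k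
power-mean-on-support xs p f k f-vanishes
  rewrite ∑-filterᵇ xs p f f-vanishes
        | ∑-filterᵇ xs p (λ x → f x ^ suc k) (λ x px → cong (_^ suc k) (f-vanishes x px))
        | ∑-toℕ≡length-filterᵇ xs p
  = power-mean (filterᵇ p xs) f k

∑-allVecs-++ : ∀ (P : List A) m m′ (f : Vec A (m + m′) → ℕ) →
  ∑ (allVecs P (m + m′)) f ≡ ∑ (allVecs P m) (λ u → ∑ (allVecs P m′) (λ v → f (u ++ v)))
∑-allVecs-++ P zero    m′ f = sym (+-identityʳ _)
∑-allVecs-++ P (suc m) m′ f = begin
  ∑ (allVecs P (suc m + m′)) f
    ≡⟨ ∑-concatMap P _ f ⟩
  ∑ P (λ x → ∑ (map (x ∷_) (allVecs P (m + m′))) f)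
    ≡⟨ ∑-cong P (λ x → ∑-map (allVecs P (m + m′)) (x ∷_) f) ⟩
  ∑ P (λ x → ∑ (allVecs P (m + m′)) (λ v → f (x ∷ v)))
    ≡⟨ ∑-cong P (λ x → ∑-allVecs-++ P m m′ (λ v → f (x ∷ v))) ⟩
  ∑ P (λ x → ∑ (allVecs P m) (λ u → ∑ (allVecs P m′) (λ v → f (x ∷ u ++ v))))
    ≡⟨ ∑-cong P (λ x → sym (∑-map (allVecs P m) (x ∷_) _)) ⟩
  ∑ P (λ x → ∑ (map (x ∷_) (allVecs P m)) (λ u → ∑ (allVecs P m′) (λ v → f (u ++ v))))
    ≡⟨ sym (∑-concatMap P _ _) ⟩
  ∑ (allVecs P (suc m)) (λ u → ∑ (allVecs P m′) (λ v → f (u ++ v))) ∎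
  where open ≡-Reasoning

∏ : ∀ j → (Fin j → ℕ) → ℕ
∏ zero    f = 1
∏ (suc j) f = f Fin.zero * ∏ j (λ i → f (Fin.suc i))

∏-cong : ∀ j {f g : Fin j → ℕ} → (∀ i → f i ≡ g i) → ∏ j f ≡ ∏ j g
∏-cong zero    f≗g = refl
∏-cong (suc j) f≗g = cong₂ _*_ (f≗g Fin.zero) (∏-cong j (λ i → f≗g (Fin.suc i)))

chunk : ∀ {j n} → Fin j → Vec A (j * n) → Vec A n
chunk i c = tabulate (λ s → lookup c (combine i s))

chunk-zero : ∀ {j n} (u : Vec A n) (c : Vec A (j * n)) → chunk {j = suc j} Fin.zero (u ++ c) ≡ u
chunk-zero u c = trans (tabulate-cong (lookup-++ˡ u c)) (tabulate∘lookup u)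

chunk-suc : ∀ {j n} (i : Fin j) (u : Vec A n) (c : Vec A (j * n)) →
            chunk {j = suc j} (Fin.suc i) (u ++ c) ≡ chunk i c
chunk-suc i u c = tabulate-cong (λ s → lookup-++ʳ u c (combine i s))

∑-allVecs-∏-chunk : ∀ (P : List A) j n (g : Vec A n → ℕ) →
  ∑ (allVecs P (j * n)) (λ c → ∏ j (λ i → g (chunk i c))) ≡ ∑ (allVecs P n) g ^ j
∑-allVecs-∏-chunk P zero    n g = refl
∑-allVecs-∏-chunk {A} P (suc j) n g = begin
  ∑ (allVecs P (n + j * n)) (λ c → ∏ (suc j) (λ i → g (chunk i c)))
    ≡⟨ ∑-allVecs-++ P n (j * n) _ ⟩
  ∑ Pₙ (λ u → ∑ Pⱼₙ (λ c → g (chunk {j = suc j} Fin.zero (u ++ c)) * ∏ j (λ i → g (chunk (Fin.suc i) (u ++ c)))))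
    ≡⟨ ∑-cong Pₙ (λ u → ∑-cong Pⱼₙ (λ c →
         cong₂ _*_ (cong g (chunk-zero {j = j} u c)) (∏-cong j (λ i → cong g (chunk-suc i u c))))) ⟩
  ∑ Pₙ (λ u → ∑ Pⱼₙ (λ c → g u * ∏ j (λ i → g (chunk i c))))
    ≡⟨ ∑-cong Pₙ (λ u → ∑-*ˡ Pⱼₙ (g u) _) ⟩
  ∑ Pₙ (λ u → g u * ∑ Pⱼₙ (λ c → ∏ j (λ i → g (chunk i c))))
    ≡⟨ ∑-*ʳ Pₙ _ g ⟩
  ∑ Pₙ g * ∑ Pⱼₙ (λ c → ∏ j (λ i → g (chunk i c)))
    ≡⟨ cong (∑ Pₙ g *_) (∑-allVecs-∏-chunk P j n g) ⟩
  ∑ Pₙ g * ∑ Pₙ g ^ j ∎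
  where
  open ≡-Reasoning
  Pₙ : List (Vec A n)
  Pₙ = allVecs P n
  Pⱼₙ : List (Vec A (j * n))
  Pⱼₙ = allVecs P (j * n)

Embeds : (E : Pt → Bool) (R : Pt → Pt → Bool) → (V → V → Bool) → (V → Pt) → Set
Embeds E R adj ψ = (∀ v → T (E (ψ v))) × (∀ v w → T (adj v w) → T (R (ψ v) (ψ w)))

IsGraphHom : (W → W → Bool) → (V → V → Bool) → (W → V) → Set
IsGraphHom a b g = ∀ x y → T (a x y) → T (b (g x) (g y))

record Covering (a : W → W → Bool) (b : V → V → Bool) (g : I → W → V) : Set where
  field
    vertices : ∀ v → ∃₂ λ i x → g i x ≡ v
    edges    : ∀ v v′ → T (b v v′) → ∃ λ i → ∃₂ λ x x′ → g i x ≡ v × g i x′ ≡ v′ × T (a x x′)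

module _ {E : Pt → Bool} {R : Pt → Pt → Bool} where

  Embeds-cong : ∀ {adj : V → V → Bool} {ψ ψ′ : V → Pt} → (∀ v → ψ v ≡ ψ′ v) →
                Embeds E R adj ψ ⇔ Embeds E R adj ψ′
  Embeds-cong {adj = adj} ψ≗ψ′ = mk⇔ (transport ψ≗ψ′) (transport (sym ∘ ψ≗ψ′))
    where
    transport : ∀ {ψ ψ′} → (∀ v → ψ v ≡ ψ′ v) → Embeds E R adj ψ → Embeds E R adj ψ′
    transport ψ≗ψ′ (inE , inR) =
      (λ v → subst (T ∘ E) (ψ≗ψ′ v) (inE v)) ,
      (λ v w e → subst₂ (λ p q → T (R p q)) (ψ≗ψ′ v) (ψ≗ψ′ w) (inR v w e))

  Embeds-∘ : ∀ {a : W → W → Bool} {b : V → V → Bool} {g : W → V} {ψ : V → Pt} →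
             IsGraphHom a b g → Embeds E R b ψ → Embeds E R a (ψ ∘ g)
  Embeds-∘ {g = g} hom (inE , edges) = (inE ∘ g) , (λ x y e → edges (g x) (g y) (hom x y e))

  Embeds-⇔-covering : ∀ {a : W → W → Bool} {b : V → V → Bool} {g : I → W → V} {ψ : V → Pt} →
    (∀ i → IsGraphHom a b (g i)) → Covering a b g →
    Embeds E R b ψ ⇔ (∀ i → Embeds E R a (ψ ∘ g i))
  Embeds-⇔-covering {a = a} {b} {g} {ψ} homs cover =
    mk⇔ (λ emb i → Embeds-∘ (homs i) emb) glue
    where
    open Covering cover
    glue : (∀ i → Embeds E R a (ψ ∘ g i)) → Embeds E R b ψ
    glue embᵢ = inE , inR
      where
      inE : ∀ v → T (E (ψ v))
      inE v with vertices v
      ... | i , x , refl = proj₁ (embᵢ i) x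
      inR : ∀ v v′ → T (b v v′) → T (R (ψ v) (ψ v′))
      inR v v′ e with edges v v′ e
      ... | i , x , x′ , refl , refl , eₐ = proj₂ (embᵢ i) x x′ eₐ

  Embeds-⇔-pullback : ∀ {b : V → V → Bool} {g : W → V} {ψ : V → Pt} →
    (∀ v → ∃ λ x → g x ≡ v) → Embeds E R b ψ ⇔ Embeds E R (λ x y → b (g x) (g y)) (ψ ∘ g)
  Embeds-⇔-pullback {b = b} {g} {ψ} g-surjective =
    mk⇔ (λ emb → to cover emb tt) (λ emb → from cover (λ _ → emb))
    where
    open Equivalence
    edges : ∀ v v′ → T (b v v′) → ∃ λ (_ : ⊤) → ∃₂ λ x x′ → g x ≡ v × g x′ ≡ v′ × T (b (g x) (g x′))
    edges v v′ e with g-surjective v | g-surjective v′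
    ... | x , refl | x′ , refl = tt , x , x′ , refl , refl , e
    cover : Embeds E R b ψ ⇔ (⊤ → Embeds E R (λ x y → b (g x) (g y)) (ψ ∘ g))
    cover = Embeds-⇔-covering (λ _ _ _ e → e) record
      { vertices = λ v → let (x , gx≡v) = g-surjective v in tt , x , gx≡v
      ; edges    = edges
      }

Π-⇔ : ∀ {P Q : I → Set} → (∀ i → P i ⇔ Q i) → (∀ i → P i) ⇔ (∀ i → Q i)
Π-⇔ P⇔Q = mk⇔ (λ p i → Equivalence.to (P⇔Q i) (p i)) (λ q i → Equivalence.from (P⇔Q i) (q i))

T-allB : ∀ (p : A → Bool) (xs : List A) → T (allB p xs) ⇔ (∀ {x} → x ∈ xs → T (p x))
T-allB p []       = mk⇔ (λ _ ()) (λ _ → tt)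
T-allB p (x ∷ xs) = mk⇔
  (λ h → λ { (here refl) → proj₁ (to T-∧ h) ; (there x∈) → to (T-allB p xs) (proj₂ (to T-∧ h)) x∈ })
  (λ h → from T-∧ (h (here refl) , from (T-allB p xs) (λ x∈ → h (there x∈))))
  where open Equivalence

T-allB-allFin : ∀ {m} (p : Fin m → Bool) → T (allB p (allFin m)) ⇔ (∀ i → T (p i))
T-allB-allFin {m} p = mk⇔ (λ h i → to (T-allB p (allFin m)) h (∈-allFin i))
                          (λ h → from (T-allB p (allFin m)) (λ {i} _ → h i))
  where open Equivalence

T-⇒ : ∀ a b → T (not a ∨ b) ⇔ (T a → T b)
T-⇒ true  b = mk⇔ (λ tb _ → tb) (λ f → f tt)
T-⇒ false b = mk⇔ (λ _ ()) (λ _ → tt)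

toℕ-∀ : ∀ j (b : Bool) (bs : Fin j → Bool) → (T b ⇔ (∀ i → T (bs i))) → toℕ b ≡ ∏ j (toℕ ∘ bs)
toℕ-∀ zero    true  bs b⇔ = refl
toℕ-∀ zero    false bs b⇔ = ⊥-elim (Equivalence.from b⇔ (λ ()))
toℕ-∀ (suc j) b     bs b⇔ with bs Fin.zero in bs₀≡ | b
... | false | false = refl
... | false | true  = ⊥-elim (subst T bs₀≡ (Equivalence.to b⇔ tt Fin.zero))
... | true  | b′    = trans (toℕ-∀ j b′ (bs ∘ Fin.suc) b⇔ₛ) (sym (+-identityʳ _))
  where
  b⇔ₛ : T b′ ⇔ (∀ i → T (bs (Fin.suc i)))
  b⇔ₛ = mk⇔ (λ tb i → Equivalence.to b⇔ tb (Fin.suc i))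
            (λ h → Equivalence.from b⇔ λ { Fin.zero → subst T (sym bs₀≡) tt ; (Fin.suc i) → h i })

atDistance : (𝔽 : FiniteOddField) {d : ℕ} → F 𝔽 → Vec (F 𝔽) d → Vec (F 𝔽) d → Bool
atDistance 𝔽 t p q = ⌊ _≟F_ 𝔽 (norm 𝔽 (vsub 𝔽 p q)) t ⌋

T-isEmbedding : ∀ (𝔽 : FiniteOddField) {d m} t (E : Vec (F 𝔽) d → Bool) (adj : Fin m → Fin m → Bool) φ →
                T (isEmbedding 𝔽 t E adj φ) ⇔ Embeds E (atDistance 𝔽 t) adj (lookup φ)
T-isEmbedding 𝔽 t E adj φ = mk⇔
  (λ h → let (inE , inR) = to T-∧ h in
    to (T-allB-allFin _) inE ,
    λ i j → to (T-⇒ (adj i j) _) (to (T-allB-allFin _) (to (T-allB-allFin _) inR i) j))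
  (λ (inE , inR) → from T-∧ (from (T-allB-allFin _) inE ,
    from (T-allB-allFin _) λ i → from (T-allB-allFin _) λ j → from (T-⇒ (adj i j) _) (inR i j)))
  where open Equivalence

data Split (n l : ℕ) : Fin (n + l) → Set where
  inˡ : (j : Fin n) → Split n l (j ↑ˡ l)
  inʳ : (y : Fin l) → Split n l (n ↑ʳ y)

split : ∀ n l x → Split n l x
split n l x with splitAt n x in eq
... | inj₁ j = subst (Split n l) (splitAt⁻¹-↑ˡ eq) (inˡ j)
... | inj₂ y = subst (Split n l) (splitAt⁻¹-↑ʳ eq) (inʳ y)

data Combined (j n : ℕ) : Fin (j * n) → Set where
  combined : (i : Fin j) (s : Fin n) → Combined j n (combine i s)

uncombine : ∀ j n x → Combined j n x
uncombine j n x = subst (Combined j n) (combine-remQuot {j} n x)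
                        (combined (proj₁ (remQuot {j} n x)) (proj₂ (remQuot {j} n x)))

module HolderExtension (n l k′ : ℕ) (a : Fin (n + l) → Fin (n + l) → Bool) where

  Vertex : Set
  Vertex = HVert n l (suc k′)

  adjG : Vertex → Vertex → Bool
  adjG = hadj n l (suc k′) a

  decodeH-orig : ∀ x → decodeH n l (suc k′) (x ↑ˡ (k′ * n)) ≡ orig x
  decodeH-orig x rewrite splitAt-↑ˡ (n + l) x (k′ * n) = refl

  decodeH-copy : ∀ i j → decodeH n l (suc k′) ((n + l) ↑ʳ combine i j) ≡ copy i j
  decodeH-copy i j rewrite splitAt-↑ʳ (n + l) (k′ * n) (combine i j) =
    cong (λ (i′ , j′) → copy i′ j′) (remQuot-combine {k′} {n} i j)

  decodeH-surjective : ∀ v → ∃ λ x → decodeH n l (suc k′) x ≡ v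
  decodeH-surjective (orig x)   = _ , decodeH-orig x
  decodeH-surjective (copy i j) = _ , decodeH-copy i j

  adjG-copyˡ-orig : ∀ i j s → adjG (copy i j) (orig (s ↑ˡ l)) ≡ false
  adjG-copyˡ-orig i j s rewrite splitAt-↑ˡ n s l = refl

  adjG-copyʳ-orig : ∀ i j y → adjG (copy i j) (orig (n ↑ʳ y)) ≡ a (j ↑ˡ l) (n ↑ʳ y)
  adjG-copyʳ-orig i j y rewrite splitAt-↑ʳ n l y = refl

  adjG-origˡ-copy : ∀ i j s → adjG (orig (s ↑ˡ l)) (copy i j) ≡ false
  adjG-origˡ-copy i j s rewrite splitAt-↑ˡ n s l = refl

  adjG-origʳ-copy : ∀ i j y → adjG (orig (n ↑ʳ y)) (copy i j) ≡ a (n ↑ʳ y) (j ↑ˡ l)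
  adjG-origʳ-copy i j y rewrite splitAt-↑ʳ n l y = refl

  adjG-copy-copy : ∀ i j j′ → adjG (copy i j) (copy i j′) ≡ a (j ↑ˡ l) (j′ ↑ˡ l)
  adjG-copy-copy i j j′ with i Fin.≟ i
  ... | yes _  = refl
  ... | no i≢i = ⊥-elim (i≢i refl)

  -- Layer zero is H itself; layer (suc i) is H with S replaced by its i-th copy.
  inLayer : Fin (suc k′) → Fin (n + l) → Vertex
  inLayer Fin.zero    x = orig x
  inLayer (Fin.suc i) x = [ copy i , (λ y → orig (n ↑ʳ y)) ]′ (splitAt n x)

  inLayer-↑ˡ : ∀ i j → inLayer (Fin.suc i) (j ↑ˡ l) ≡ copy i j
  inLayer-↑ˡ i j rewrite splitAt-↑ˡ n j l = refl

  inLayer-↑ʳ : ∀ α y → inLayer α (n ↑ʳ y) ≡ orig (n ↑ʳ y)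
  inLayer-↑ʳ Fin.zero    y = refl
  inLayer-↑ʳ (Fin.suc i) y rewrite splitAt-↑ʳ n l y = refl

  adjG-inLayer : ∀ α x x′ → adjG (inLayer α x) (inLayer α x′) ≡ a x x′
  adjG-inLayer Fin.zero    x x′ = refl
  adjG-inLayer (Fin.suc i) x x′ with split n l x | split n l x′
  ... | inˡ j | inˡ j′
    rewrite inLayer-↑ˡ i j | inLayer-↑ˡ i j′ = adjG-copy-copy i j j′
  ... | inˡ j | inʳ y′
    rewrite inLayer-↑ˡ i j | inLayer-↑ʳ (Fin.suc i) y′ = adjG-copyʳ-orig i j y′
  ... | inʳ y | inˡ j′
    rewrite inLayer-↑ʳ (Fin.suc i) y | inLayer-↑ˡ i j′ = adjG-origʳ-copy i j′ y
  ... | inʳ y | inʳ y′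
    rewrite inLayer-↑ʳ (Fin.suc i) y | inLayer-↑ʳ (Fin.suc i) y′ = refl

  inLayer-hom : ∀ α → IsGraphHom a adjG (inLayer α)
  inLayer-hom α x x′ = subst T (sym (adjG-inLayer α x x′))

  layers-cover : Covering a adjG inLayer
  layers-cover = record { vertices = vertices ; edges = edges }
    where
    vertices : ∀ v → ∃₂ λ α x → inLayer α x ≡ v
    vertices (orig x)   = Fin.zero , x , refl
    vertices (copy i j) = Fin.suc i , j ↑ˡ l , inLayer-↑ˡ i j

    edges : ∀ v v′ → T (adjG v v′) →
            ∃ λ α → ∃₂ λ x x′ → inLayer α x ≡ v × inLayer α x′ ≡ v′ × T (a x x′)
    edges (orig x)   (orig x′)   e = Fin.zero , x , x′ , refl , refl , e
    edges (copy i j) (copy i′ j′) e with i Fin.≟ i′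
    ... | yes refl = Fin.suc i , j ↑ˡ l , j′ ↑ˡ l , inLayer-↑ˡ i j , inLayer-↑ˡ i j′ , e
    ... | no _     = ⊥-elim e
    edges (copy i j) (orig x)    e with split n l x
    ... | inˡ s = ⊥-elim (subst T (adjG-copyˡ-orig i j s) e)
    ... | inʳ y = Fin.suc i , j ↑ˡ l , n ↑ʳ y , inLayer-↑ˡ i j , inLayer-↑ʳ (Fin.suc i) y ,
                  subst T (adjG-copyʳ-orig i j y) e
    edges (orig x)   (copy i j)  e with split n l x
    ... | inˡ s = ⊥-elim (subst T (adjG-origˡ-copy i j s) e)
    ... | inʳ y = Fin.suc i , n ↑ʳ y , j ↑ˡ l , inLayer-↑ʳ (Fin.suc i) y , inLayer-↑ˡ i j ,
                  subst T (adjG-origʳ-copy i j y) e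

module GluedEmbedding (𝔽 : FiniteOddField) {d : ℕ} (t : F 𝔽) (E : Vec (F 𝔽) d → Bool)
                      (n l k′ : ℕ) (a : Fin (n + l) → Fin (n + l) → Bool)
                      (u : Vec (Vec (F 𝔽) d) n) (w : Vec (Vec (F 𝔽) d) l)
                      (c : Vec (Vec (F 𝔽) d) (k′ * n)) where
  open HolderExtension n l k′ a

  R : Vec (F 𝔽) d → Vec (F 𝔽) d → Bool
  R = atDistance 𝔽 t

  labelling : Vertex → Vec (F 𝔽) d
  labelling (orig x)   = lookup (u ++ w) x
  labelling (copy i j) = lookup (chunk i c) j

  layer : Fin (suc k′) → Vec (Vec (F 𝔽) d) (n + l)
  layer Fin.zero    = u ++ w
  layer (Fin.suc i) = chunk i c ++ w

  lookup-layer : ∀ α x → lookup (layer α) x ≡ labelling (inLayer α x)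
  lookup-layer Fin.zero    x = refl
  lookup-layer (Fin.suc i) x with split n l x
  ... | inˡ j rewrite inLayer-↑ˡ i j = lookup-++ˡ (chunk i c) w j
  ... | inʳ y rewrite inLayer-↑ʳ (Fin.suc i) y =
    trans (lookup-++ʳ (chunk i c) w y) (sym (lookup-++ʳ u w y))

  lookup-glued : ∀ x → lookup ((u ++ w) ++ c) x ≡ labelling (decodeH n l (suc k′) x)
  lookup-glued x with split (n + l) (k′ * n) x
  ... | inˡ x₀ rewrite decodeH-orig x₀ = lookup-++ˡ (u ++ w) c x₀
  ... | inʳ z with uncombine k′ n z
  ...   | combined i j rewrite decodeH-copy i j =
    trans (lookup-++ʳ (u ++ w) c (combine i j)) (sym (lookup∘tabulate (λ s → lookup c (combine i s)) j))

  T-isEmbedding-glued : T (isEmbedding 𝔽 t E (holderExt n l (suc k′) a) ((u ++ w) ++ c)) ⇔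
                        (∀ α → T (isEmbedding 𝔽 t E a (layer α)))
  T-isEmbedding-glued = begin
    T (isEmbedding 𝔽 t E (holderExt n l (suc k′) a) ((u ++ w) ++ c))
      ∼⟨ T-isEmbedding 𝔽 t E (holderExt n l (suc k′) a) ((u ++ w) ++ c) ⟩
    Embeds E R (holderExt n l (suc k′) a) (lookup ((u ++ w) ++ c))
      ∼⟨ Embeds-cong {E = E} {R} lookup-glued ⟩
    Embeds E R (holderExt n l (suc k′) a) (labelling ∘ decodeH n l (suc k′))
      ∼⟨ ⇔.sym (Embeds-⇔-pullback {E = E} {R} decodeH-surjective) ⟩
    Embeds E R adjG labelling
      ∼⟨ Embeds-⇔-covering {E = E} {R} inLayer-hom layers-cover ⟩
    (∀ α → Embeds E R a (labelling ∘ inLayer α))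
      ∼⟨ Π-⇔ (λ α → ⇔.sym (Embeds-cong {E = E} {R} (lookup-layer α))) ⟩
    (∀ α → Embeds E R a (lookup (layer α)))
      ∼⟨ Π-⇔ (λ α → ⇔.sym (T-isEmbedding 𝔽 t E a (layer α))) ⟩
    (∀ α → T (isEmbedding 𝔽 t E a (layer α))) ∎
    where open EquationalReasoning

module Counts (𝔽 : FiniteOddField) {d : ℕ} (t : F 𝔽) (E : Vec (F 𝔽) d → Bool)
              (n l : ℕ) (a : Fin (n + l) → Fin (n + l) → Bool) where

  Point : Set
  Point = Vec (F 𝔽) d

  Pts : List Point
  Pts = allVecs (elems 𝔽) d

  R : Point → Point → Bool
  R = atDistance 𝔽 t

  extensions : Vec Point l → ℕ
  extensions w = ∑ (allVecs Pts n) (λ u → toℕ (isEmbedding 𝔽 t E a (u ++ w)))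

  𝒩≡∑-extensions : 𝒩 𝔽 t E a ≡ ∑ (allVecs Pts l) extensions
  𝒩≡∑-extensions = begin
    𝒩 𝔽 t E a
      ≡⟨ countTrue≡∑ _ (allVecs Pts (n + l)) ⟩
    ∑ (allVecs Pts (n + l)) (toℕ ∘ isEmbedding 𝔽 t E a)
      ≡⟨ ∑-allVecs-++ Pts n l _ ⟩
    ∑ (allVecs Pts n) (λ u → ∑ (allVecs Pts l) (λ w → toℕ (isEmbedding 𝔽 t E a (u ++ w))))
      ≡⟨ ∑-swap (allVecs Pts n) (allVecs Pts l) _ ⟩
    ∑ (allVecs Pts l) extensions ∎
    where open ≡-Reasoning

  𝒩-holderExt≡∑-extensions^k : ∀ k′ →
    𝒩 𝔽 t E (holderExt n l (suc k′) a) ≡ ∑ (allVecs Pts l) (λ w → extensions w ^ suc k′)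
  𝒩-holderExt≡∑-extensions^k k′ = begin
    𝒩 𝔽 t E G
      ≡⟨ countTrue≡∑ _ (allVecs Pts ((n + l) + k′ * n)) ⟩
    ∑ (allVecs Pts ((n + l) + k′ * n)) (toℕ ∘ isEmbedding 𝔽 t E G)
      ≡⟨ ∑-allVecs-++ Pts (n + l) (k′ * n) _ ⟩
    ∑ (allVecs Pts (n + l)) (λ v → ∑ Cs (λ c → toℕ (isEmbedding 𝔽 t E G (v ++ c))))
      ≡⟨ ∑-allVecs-++ Pts n l _ ⟩
    ∑ Us (λ u → ∑ Ws (λ w → ∑ Cs (λ c → toℕ (isEmbedding 𝔽 t E G ((u ++ w) ++ c)))))
      ≡⟨ ∑-cong Us (λ u → ∑-cong Ws (λ w → ∑-cong Cs (λ c → toℕ-glued u w c))) ⟩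
    ∑ Us (λ u → ∑ Ws (λ w → ∑ Cs (λ c → emb (u ++ w) * ∏ k′ (λ i → emb (chunk i c ++ w)))))
      ≡⟨ ∑-cong Us (λ u → ∑-cong Ws (λ w → ∑-*ˡ Cs (emb (u ++ w)) _)) ⟩
    ∑ Us (λ u → ∑ Ws (λ w → emb (u ++ w) * ∑ Cs (λ c → ∏ k′ (λ i → emb (chunk i c ++ w)))))
      ≡⟨ ∑-cong Us (λ u → ∑-cong Ws (λ w →
           cong (emb (u ++ w) *_) (∑-allVecs-∏-chunk Pts k′ n (λ s → emb (s ++ w))))) ⟩
    ∑ Us (λ u → ∑ Ws (λ w → emb (u ++ w) * extensions w ^ k′))
      ≡⟨ ∑-swap Us Ws _ ⟩
    ∑ Ws (λ w → ∑ Us (λ u → emb (u ++ w) * extensions w ^ k′))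
      ≡⟨ ∑-cong Ws (λ w → ∑-*ʳ Us (extensions w ^ k′) _) ⟩
    ∑ Ws (λ w → extensions w ^ suc k′) ∎
    where
    open ≡-Reasoning
    G : Fin ((n + l) + k′ * n) → Fin ((n + l) + k′ * n) → Bool
    G = holderExt n l (suc k′) a
    Us : List (Vec Point n)
    Us = allVecs Pts n
    Ws : List (Vec Point l)
    Ws = allVecs Pts l
    Cs : List (Vec Point (k′ * n))
    Cs = allVecs Pts (k′ * n)
    emb : Vec Point (n + l) → ℕ
    emb = toℕ ∘ isEmbedding 𝔽 t E a
    toℕ-glued : ∀ u w c →
      toℕ (isEmbedding 𝔽 t E G ((u ++ w) ++ c)) ≡ emb (u ++ w) * ∏ k′ (λ i → emb (chunk i c ++ w))
    toℕ-glued u w c = toℕ-∀ (suc k′) _ _ T-isEmbedding-glued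
      where open GluedEmbedding 𝔽 t E n l k′ a u w c

  isEmbedding-restrict : ∀ u w → T (isEmbedding 𝔽 t E a (u ++ w)) →
                         T (isEmbedding 𝔽 t E (deleteS n l a) w)
  isEmbedding-restrict u w emb =
    from (T-isEmbedding 𝔽 t E (deleteS n l a) w)
      (to (Embeds-cong {E = E} {R} (lookup-++ʳ u w))
        (Embeds-∘ {E = E} {R} {g = n ↑ʳ_} (λ _ _ e → e) (to (T-isEmbedding 𝔽 t E a (u ++ w)) emb)))
    where open Equivalence

  extensions-vanish : ∀ w → isEmbedding 𝔽 t E (deleteS n l a) w ≡ false → extensions w ≡ 0
  extensions-vanish w not-emb = trans (∑-cong (allVecs Pts n) no-extension) (∑-zero (allVecs Pts n))
    where
    no-extension : ∀ u → toℕ (isEmbedding 𝔽 t E a (u ++ w)) ≡ 0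
    no-extension u with isEmbedding 𝔽 t E a (u ++ w) in emb
    ... | true  = ⊥-elim (subst T not-emb (isEmbedding-restrict u w (subst T (sym emb) _)))
    ... | false = refl

mainTheorem1 : (𝔽 : FiniteOddField) (d : ℕ) → 2 ≤ d
    → (t : F 𝔽) → t ≢ 0F 𝔽
    → (E : Vec (F 𝔽) d → Bool)
    → (n l : ℕ) (H : SimpleGraph (n + l))
    → (k : ℕ) → 2 ≤ k
    → 0 < 𝒩 𝔽 t E (deleteS n l (adj H))
    → 𝒩 𝔽 t E (adj H) ^ k
      ≤ 𝒩 𝔽 t E (holderExt n l k (adj H)) * 𝒩 𝔽 t E (deleteS n l (adj H)) ^ (k ∸ 1)
mainTheorem1 𝔽 d _ t _ E n l H (suc k′) _ _ = begin
  𝒩 𝔽 t E (adj H) ^ suc k′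
    ≡⟨ cong (_^ suc k′) 𝒩≡∑-extensions ⟩
  ∑ Ws extensions ^ suc k′
    ≤⟨ power-mean-on-support Ws (isEmbedding 𝔽 t E H∖S) extensions k′ extensions-vanish ⟩
  ∑ Ws (λ w → extensions w ^ suc k′) * ∑ Ws (toℕ ∘ isEmbedding 𝔽 t E H∖S) ^ k′
    ≡⟨ sym (cong₂ _*_ (𝒩-holderExt≡∑-extensions^k k′) (cong (_^ k′) (countTrue≡∑ _ Ws))) ⟩
  𝒩 𝔽 t E (holderExt n l (suc k′) (adj H)) * 𝒩 𝔽 t E H∖S ^ k′ ∎
  where
  open ≤-Reasoning
  open Counts 𝔽 t E n l (adj H)
  H∖S : Fin l → Fin l → Bool
  H∖S = deleteS n l (adj H)
  Ws : List (Vec Point l)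
  Ws = allVecs Pts l
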